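{- Let $n\ge 12$ be even, and let $t$ be the number of (distinct) prime factors of $n-1$. Then $\pi(n)\ge t+4$.
   Context: $\pi(n)$ denotes the number of primes less than $n$. -}

module Defs where

open import Data.Nat using (ℕ; suc)
open import Data.Nat.Primality using (Prime; prime?)
open import Data.Nat.Divisibility using (_∣_; _∣?_)
open import Data.List using (List; upTo; filter; length)
open import Data.Product using (_×_)
open import Relation.Nullary.Decidable using (_×-dec_)

π : ℕ → ℕ
π n = length (filter prime? (upTo n))

-- ω m = number of distinct primes dividing m, for m ≥ 1
-- (every prime divisor of m ≥ 1 is ≤ m, so searching p < suc m is exhaustive)
ω : ℕ → ℕ
ω m = length (filter (λ p → prime? p ×-dec (p ∣? m)) (upTo (suc m)))

module Submission where

-- Let n ≥ 12 be even and m = n - 1, so m ≥ 11 is odd.  The primes below n are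
-- exactly the primes p ≤ m, and they split into those dividing m (ω m of
-- them) and those not dividing m.  It therefore suffices to exhibit four
-- distinct primes p ≤ m with p ∤ m.
--
-- The prime 2 is one of them.  The others are odd prime
-- factors of the odd numbers m - 2, m - 4, m - 6, m - 8: an odd prime dividing
-- m - d cannot divide m when d is a power of two (or when d = 6 and the
-- prime is not 3), and two such factors of m - d and m - d' differ for the
-- same reason.  If 3 ∤ m - 8 we take odd prime factors of m - 2, m - 4 and
-- m - 8; if 3 ∣ m - 8 we take 3 itself together with odd prime factors of
-- m - 4 and m - 6.

open import Data.Nat
open import Data.Nat.Properties
open import Data.Nat.Divisibility
open import Data.Nat.Primality
open import Data.Nat.Primality.Factorisation using (factorise)
open import Data.Nat.ListAction using (product)
open import Data.List using (List; []; _∷_; upTo; filter; length)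
open import Data.List.Properties using (length-removeAt′)
open import Data.List.Relation.Unary.Any using (here; there; index; _─_)
open import Data.List.Relation.Unary.All as All using (All; []; _∷_)
open import Data.List.Relation.Unary.AllPairs using ([]; _∷_)
open import Data.List.Relation.Unary.Unique.Propositional using (Unique)
open import Data.List.Membership.Propositional using (_∈_)
open import Data.List.Membership.Propositional.Properties using (∈-filter⁺; ∈-upTo⁺)
open import Data.List.Relation.Binary.Subset.Propositional using (_⊆_)
open import Data.Product using (_×_; _,_; ∃-syntax)
open import Data.Sum using (inj₁; inj₂)
open import Data.Empty using (⊥-elim)
open import Level using (0ℓ)
open import Relation.Nullary using (¬_; yes; no)
open import Relation.Nullary.Decidable using (toWitness)
open import Relation.Unary using (Pred; Decidable; _∩_; ∁)
open import Relation.Unary.Properties using (_∩?_; ∁?)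
open import Relation.Binary.PropositionalEquality
open import Defs

private
  variable
    k m p q x y : ℕ

count : {P : Pred ℕ 0ℓ} → Decidable P → ℕ → ℕ
count P? n = length (filter P? (upTo n))

length-filter-split : {A : Set} {P Q : Pred A 0ℓ} (P? : Decidable P) (Q? : Decidable Q) →
  ∀ xs → length (filter P? xs)
       ≡ length (filter (P? ∩? Q?) xs) + length (filter (P? ∩? ∁? Q?) xs)
length-filter-split P? Q? [] = refl
length-filter-split P? Q? (x ∷ xs) with P? x | Q? x
... | yes _ | yes _ = cong suc (length-filter-split P? Q? xs)
... | yes _ | no _  = trans (cong suc (length-filter-split P? Q? xs)) (sym (+-suc _ _))
... | no _  | _     = length-filter-split P? Q? xs

module _ {A : Set} where

  ∈-─ : ∀ {x y : A} {ys} → y ∈ ys → (x∈ys : x ∈ ys) → y ≢ x → y ∈ (ys ─ x∈ys)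
  ∈-─ (here refl)  (here refl) y≢x = ⊥-elim (y≢x refl)
  ∈-─ (here y≡z)   (there _)   _   = here y≡z
  ∈-─ (there y∈ys) (here _)    _   = y∈ys
  ∈-─ (there y∈ys) (there x∈ys) y≢x = there (∈-─ y∈ys x∈ys y≢x)

  unique-⊆⇒length≤ : ∀ {xs ys : List A} → Unique xs → xs ⊆ ys → length xs ≤ length ys
  unique-⊆⇒length≤ {[]}     _                  _     = z≤n
  unique-⊆⇒length≤ {x ∷ xs} {ys} (x∉xs ∷ uniq) xs⊆ys = begin
    suc (length xs)           ≤⟨ s≤s (unique-⊆⇒length≤ uniq tail⊆) ⟩
    suc (length (ys ─ x∈ys))  ≡⟨ sym (length-removeAt′ ys (index x∈ys)) ⟩
    length ys                 ∎
    where
    open ≤-Reasoning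
    x∈ys : x ∈ ys
    x∈ys = xs⊆ys (here refl)
    tail⊆ : xs ⊆ (ys ─ x∈ys)
    tail⊆ y∈xs = ∈-─ (xs⊆ys (there y∈xs)) x∈ys (≢-sym (All.lookup x∉xs y∈xs))

count-lowerBound : {P : Pred ℕ 0ℓ} (P? : Decidable P) → ∀ {n} {xs : List ℕ} →
  Unique xs → All (λ x → x < n × P x) xs → length xs ≤ count P? n
count-lowerBound P? uniq witnesses = unique-⊆⇒length≤ uniq λ x∈xs →
  let (x<n , px) = All.lookup witnesses x∈xs in ∈-filter⁺ P? (∈-upTo⁺ x<n) px

PrimeNonDivisor : ℕ → Pred ℕ 0ℓ
PrimeNonDivisor m = Prime ∩ ∁ (_∣ m)

primeNonDivisor? : ∀ m → Decidable (PrimeNonDivisor m)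
primeNonDivisor? m = prime? ∩? ∁? (_∣? m)

π-split : ∀ m → π (suc m) ≡ ω m + count (primeNonDivisor? m) (suc m)
π-split m = length-filter-split prime? (_∣? m) (upTo (suc m))

prime[3] : Prime 3
prime[3] = toWitness {a? = prime? 3} _

primeFactor : ∀ n .{{_ : NonTrivial n}} → ∃[ p ] (Prime p × p ∣ n)
primeFactor n with factorise n {{nonTrivial⇒nonZero n}}
... | record { factors = [] ; isFactorisation = n≡1 } = ⊥-elim (nonTrivial⇒≢1 {n} n≡1)
... | record { factors = p ∷ ps ; isFactorisation = eq ; factorsPrime = pp ∷ _ } =
  p , pp , subst (p ∣_) (sym eq) (m∣m*n (product ps))

prime∣prime⇒≡ : Prime p → Prime q → p ∣ q → p ≡ q
prime∣prime⇒≡ pp pq p∣q with prime⇒irreducible pq p∣q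
... | inj₁ refl = ⊥-elim (¬prime[1] pp)
... | inj₂ p≡q  = p≡q

prime∣2^j⇒≡2 : ∀ j → Prime p → p ∣ 2 ^ j → p ≡ 2
prime∣2^j⇒≡2 zero    pp p∣1 = ⊥-elim (¬prime[1] (subst Prime (∣1⇒≡1 p∣1) pp))
prime∣2^j⇒≡2 (suc j) pp p∣2^sj with euclidsLemma 2 (2 ^ j) pp p∣2^sj
... | inj₁ p∣2   = prime∣prime⇒≡ pp prime[2] p∣2
... | inj₂ p∣2^j = prime∣2^j⇒≡2 j pp p∣2^j

oddPrime∤2^j : ∀ j → Prime p → p ≢ 2 → ¬ p ∣ 2 ^ j
oddPrime∤2^j j pp p≢2 p∣2^j = p≢2 (prime∣2^j⇒≡2 j pp p∣2^j)

prime∤6 : Prime p → p ≢ 2 → p ≢ 3 → ¬ p ∣ 6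
prime∤6 pp p≢2 p≢3 p∣6 with euclidsLemma 2 3 pp p∣6
... | inj₁ p∣2 = p≢2 (prime∣prime⇒≡ pp prime[2] p∣2)
... | inj₂ p∣3 = p≢3 (prime∣prime⇒≡ pp prime[3] p∣3)

∤-shift : ∀ {p x d} → p ∣ x → ¬ p ∣ d → ¬ p ∣ d + x
∤-shift {p} {x} {d} p∣x p∤d p∣d+x =
  p∤d (∣m+n∣m⇒∣n (subst (p ∣_) (+-comm d x) p∣d+x) p∣x)

≢-by : ¬ q ∣ y → p ∣ y → p ≢ q
≢-by q∤y p∣y refl = q∤y p∣y

odd-2+ : ¬ 2 ∣ 2 + x → ¬ 2 ∣ x
odd-2+ odd 2∣x = odd (∣m∣n⇒∣m+n ∣-refl 2∣x)

record OddPrimeFactor (x : ℕ) : Set where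
  field
    factor  : ℕ
    isPrime : Prime factor
    ≢2      : factor ≢ 2
    ∣x      : factor ∣ x

oddPrimeFactor : ∀ x .{{_ : NonTrivial x}} → ¬ 2 ∣ x → OddPrimeFactor x
oddPrimeFactor x odd with primeFactor x
... | p , pp , p∣x = record { factor = p ; isPrime = pp ; ≢2 = ≢-by odd p∣x ; ∣x = p∣x }

nonDivisorBelow : ∀ d {x} .{{_ : NonZero x}} → Prime p → p ∣ x → ¬ p ∣ d →
  p < suc (d + x) × PrimeNonDivisor (d + x) p
nonDivisorBelow d {x} pp p∣x p∤d =
  s≤s (≤-trans (∣⇒≤ p∣x) (m≤n+m x d)) , pp , ∤-shift p∣x p∤d

two-nonDivisorBelow : ¬ 2 ∣ 11 + k → 2 < suc (11 + k) × PrimeNonDivisor (11 + k) 2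
two-nonDivisorBelow odd = s≤s (s≤s (s≤s z≤n)) , prime[2] , odd

fourNonDivisors-3∤ : ¬ 2 ∣ 11 + k → ¬ 3 ∣ 3 + k →
  4 ≤ count (primeNonDivisor? (11 + k)) (12 + k)
fourNonDivisors-3∤ {k} odd11 3∤3+k = count-lowerBound (primeNonDivisor? (11 + k))
  ((≢-sym a≢2 ∷ ≢-sym b≢2 ∷ ≢-sym c≢2 ∷ []) ∷ (a≢b ∷ a≢c ∷ []) ∷ (b≢c ∷ []) ∷ [] ∷ [])
  (two-nonDivisorBelow odd11
    ∷ nonDivisorBelow 2 pa a∣ (oddPrime∤2^j 1 pa a≢2)
    ∷ nonDivisorBelow 4 pb b∣ (oddPrime∤2^j 2 pb b≢2)
    ∷ nonDivisorBelow 8 pc c∣ (oddPrime∤2^j 3 pc c≢2) ∷ [])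
  where
  odd9 : ¬ 2 ∣ 9 + k
  odd9 = odd-2+ odd11
  odd7 : ¬ 2 ∣ 7 + k
  odd7 = odd-2+ odd9
  open OddPrimeFactor (oddPrimeFactor (9 + k) odd9)
    renaming (factor to a; isPrime to pa; ≢2 to a≢2; ∣x to a∣)
  open OddPrimeFactor (oddPrimeFactor (7 + k) odd7)
    renaming (factor to b; isPrime to pb; ≢2 to b≢2; ∣x to b∣)
  open OddPrimeFactor (oddPrimeFactor (3 + k) (odd-2+ (odd-2+ odd7)))
    renaming (factor to c; isPrime to pc; ≢2 to c≢2; ∣x to c∣)
  a≢b : a ≢ b
  a≢b = ≢-by (∤-shift b∣ (oddPrime∤2^j 1 pb b≢2)) a∣
  b≢c : b ≢ c
  b≢c = ≢-by (∤-shift c∣ (oddPrime∤2^j 2 pc c≢2)) b∣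
  a≢c : a ≢ c
  a≢c = ≢-by (∤-shift c∣ (prime∤6 pc c≢2 (≢-by 3∤3+k c∣))) a∣

fourNonDivisors-3∣ : ¬ 2 ∣ 11 + k → 3 ∣ 3 + k →
  4 ≤ count (primeNonDivisor? (11 + k)) (12 + k)
fourNonDivisors-3∣ {k} odd11 3∣3+k = count-lowerBound (primeNonDivisor? (11 + k))
  (((λ ()) ∷ ≢-sym b≢2 ∷ ≢-sym c≢2 ∷ []) ∷ (3≢b ∷ 3≢c ∷ []) ∷ (b≢c ∷ []) ∷ [] ∷ [])
  (two-nonDivisorBelow odd11
    ∷ nonDivisorBelow 8 prime[3] 3∣3+k (oddPrime∤2^j 3 prime[3] (λ ()))
    ∷ nonDivisorBelow 4 pb b∣ (oddPrime∤2^j 2 pb b≢2)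
    ∷ nonDivisorBelow 6 pc c∣ (prime∤6 pc c≢2 (≢-sym 3≢c)) ∷ [])
  where
  odd7 : ¬ 2 ∣ 7 + k
  odd7 = odd-2+ (odd-2+ odd11)
  open OddPrimeFactor (oddPrimeFactor (7 + k) odd7)
    renaming (factor to b; isPrime to pb; ≢2 to b≢2; ∣x to b∣)
  open OddPrimeFactor (oddPrimeFactor (5 + k) (odd-2+ odd7))
    renaming (factor to c; isPrime to pc; ≢2 to c≢2; ∣x to c∣)
  3≢b : 3 ≢ b
  3≢b = ≢-sym (≢-by (∤-shift 3∣3+k (oddPrime∤2^j 2 prime[3] (λ ()))) b∣)
  3≢c : 3 ≢ c
  3≢c = ≢-sym (≢-by (∤-shift 3∣3+k (oddPrime∤2^j 1 prime[3] (λ ()))) c∣)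
  b≢c : b ≢ c
  b≢c = ≢-by (∤-shift c∣ (oddPrime∤2^j 1 pc c≢2)) b∣

fourNonDivisors : 11 ≤ m → ¬ 2 ∣ m → 4 ≤ count (primeNonDivisor? m) (suc m)
fourNonDivisors 11≤m odd with m≤n⇒∃[o]m+o≡n 11≤m
... | k , refl with 3 ∣? (3 + k)
...   | yes 3∣3+k = fourNonDivisors-3∣ odd 3∣3+k
...   | no  3∤3+k = fourNonDivisors-3∤ odd 3∤3+k

even⇒pred-odd : 2 ∣ suc m → ¬ 2 ∣ m
even⇒pred-odd 2∣1+m 2∣m with ∣1⇒≡1 (∣m+n∣m⇒∣n (subst (2 ∣_) (+-comm 1 _) 2∣1+m) 2∣m)
... | ()

lemma2p7 : (n : ℕ) → 12 ≤ n → 2 ∣ n → ω (n ∸ 1) + 4 ≤ π n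
lemma2p7 n 12≤n 2∣n with m≤n⇒∃[o]m+o≡n 12≤n
... | k , refl = begin
  ω (11 + k) + 4
    ≤⟨ +-monoʳ-≤ (ω (11 + k)) (fourNonDivisors (m≤m+n 11 k) (even⇒pred-odd 2∣n)) ⟩
  ω (11 + k) + count (primeNonDivisor? (11 + k)) (12 + k)
    ≡⟨ sym (π-split (11 + k)) ⟩
  π (12 + k) ∎
  where open ≤-Reasoning
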